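{- Let $(G,\beta)$ be an edge-labeled graph (in the setting described in the context) with vertices $v_1,\dots,v_n$, and let $(G_{red},\beta_{red})$ be the graph obtained from $(G,\beta)$ by successively taking reduced graphs associated to the vertices $v_n,v_{n-1},\dots,v_{i+1}$. Let $\psi:\hat R_G\to\hat R_{G_{red}}$, $\psi(f_{v_1},\dots,f_{v_n})=(f_{v_1},\dots,f_{v_i})$. Then the image of $\psi$ is $\hat{\mathcal F}_1\cup\hat{\mathcal F}_2\cup\cdots\cup\hat{\mathcal F}_i\cup\{(0,\dots,0)\}$, where $\hat{\mathcal F}_j$ ($1\le j\le i$) denotes the set of $j$-th flow-up classes of $\hat R_{G_{red}}$.
   Context: Setting: $G$ is a finite connected simple graph. Each vertex $v$ is labeled by $M_v=m_v\mathbb{Z}$ ($m_v\in\mathbb{Z}$), each edge $e$ by $\mathbb{Z}/r_e\mathbb{Z}$ ($r_e\in\mathbb{Z}$). A spline is $f\in\prod_v M_v$ with $f_u-f_v\in r_e\mathbb{Z}$ for every edge $e=uv$; $\hat R_G$ is the $\mathbb{Z}$-module of splines. A $j$-th flow-up class is a spline $F$ with $f_{v_j}\neq0$ and $f_{v_s}=0$ for all $s<j$. $(a,b,\dots)$ denotes gcd and $[a,b,\dots]$ lcm. Reduced graph associated to a vertex $v$: (1) delete $v$ and its incident edges; each neighbor $w$ of $v$ is kept with vertex module replaced by $[m_w,(m_v,r_{vw})]\mathbb{Z}$; for each pair of distinct neighbors $w,w'$ of $v$ add an edge $ww'$ labeled $(r_{vw},r_{vw'})$; (2) replace any set of parallel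 edges with labels $r_1,\dots,r_k$ by a single edge labeled $[r_1,\dots,r_k]$. -}

module Defs where

open import Data.Nat using (ℕ; zero; suc; _+_)
open import Data.Nat.Properties using (m≤n+m)
open import Data.Fin using (Fin; fromℕ; inject₁; inject≤; _≟_; _<_)
open import Data.Integer using (ℤ; _-_; 0ℤ)
open import Data.Integer.Divisibility using (_∣_)
open import Data.Integer.GCD using (gcd)
open import Data.Integer.LCM using (lcm)
open import Data.Maybe using (Maybe; just; nothing; maybe)
open import Data.Product using (Σ; _×_; ∃)
open import Relation.Nullary using (¬_; yes; no)
open import Relation.Binary.PropositionalEquality using (_≡_)

-- An edge-labeled graph on vertices Fin n (v₁,…,vₙ ↔ 0,…,n-1):
-- vmod v = m_v  (vertex module m_v ℤ),
-- elab u w = just r  iff  uw is an edge with label ℤ/rℤ; nothing = no edge.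
record LGraph (n : ℕ) : Set where
  constructor mkLGraph
  field
    vmod : Fin n → ℤ
    elab : Fin n → Fin n → Maybe ℤ
open LGraph public

IsSimple : ∀ {n} → LGraph n → Set
IsSimple G = (∀ u → elab G u u ≡ nothing) × (∀ u w → elab G u w ≡ elab G w u)

data Path {n : ℕ} (G : LGraph n) : Fin n → Fin n → Set where
  here : ∀ {u} → Path G u u
  step : ∀ {u w v} (r : ℤ) → elab G u w ≡ just r → Path G w v → Path G u v

IsConnected : ∀ {n} → LGraph n → Set
IsConnected {n} G = ∀ (u v : Fin n) → Path G u v

IsSpline : ∀ {n} → LGraph n → (Fin n → ℤ) → Set
IsSpline G f = (∀ v → vmod G v ∣ f v)
             × (∀ u w r → elab G u w ≡ just r → r ∣ (f u - f w))

IsFlowUp : ∀ {n} → LGraph n → Fin n → (Fin n → ℤ) → Set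
IsFlowUp G j F = IsSpline G F × ¬ (F j ≡ 0ℤ) × (∀ s → s < j → F s ≡ 0ℤ)

-- merging parallel edges: labels r₁, r₂ become lcm
mergeLab : Maybe ℤ → Maybe ℤ → Maybe ℤ
mergeLab nothing  y        = y
mergeLab (just a) nothing  = just a
mergeLab (just a) (just b) = just (lcm a b)

-- new edge between two neighbours w, w' of v, labeled gcd(r_vw, r_vw')
newLab : Maybe ℤ → Maybe ℤ → Maybe ℤ
newLab (just r) (just s) = just (gcd r s)
newLab _        _        = nothing

reduceLast : ∀ {n} → LGraph (suc n) → LGraph n
reduceLast {n} G = mkLGraph m' e'
  where
    v : Fin (suc n)
    v = fromℕ n
    m' : Fin n → ℤ
    m' w = maybe (λ r → lcm (vmod G (inject₁ w)) (gcd (vmod G v) r))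
                 (vmod G (inject₁ w)) (elab G v (inject₁ w))
    e' : Fin n → Fin n → Maybe ℤ
    e' w x with w ≟ x
    ... | yes _ = nothing
    ... | no  _ = mergeLab (elab G (inject₁ w) (inject₁ x))
                           (newLab (elab G v (inject₁ w)) (elab G v (inject₁ x)))

reduceMany : ∀ {i} k → LGraph (k + i) → LGraph i
reduceMany zero    G = G
reduceMany (suc k) G = reduceMany k (reduceLast G)

restrict : ∀ {i} k → (Fin (k + i) → ℤ) → (Fin i → ℤ)
restrict {i} k f j = f (inject≤ j (m≤n+m i k))

{-# OPTIONS --safe #-}
module Submission where

-- Deleting the last vertex v keeps every spline condition among the remaining
-- vertices: the new conditions of the reduced graph, gcd(r_vw, r_vw') ∣ f_w - f_w'
-- and gcd(m_v, r_vw) ∣ f_w, follow by passing through f_v.  Conversely these are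
-- exactly the compatibility conditions of the Chinese remainder theorem for
-- non-coprime moduli, so the system f_v ≡ 0 (mod m_v), f_v ≡ f_w (mod r_vw) can be
-- solved and every spline of the reduced graph extends to G.  Hence ψ is onto the
-- splines of G_red, and a nonzero spline is a flow-up class for its first nonzero
-- vertex.

open import Defs
open import Data.Nat.Base using (ℕ; zero; suc; _+_; _≤_; ≢-nonZero)
import Data.Nat.Base as ℕ
import Data.Nat.Properties as ℕ
import Data.Nat.Divisibility as ℕ
import Data.Nat.GCD as ℕ
open import Data.Fin.Base using (Fin; zero; suc; fromℕ; inject₁; inject≤; fromℕ<; inject; _<_)
open import Data.Fin.Properties
  using (_≟_; toℕ-injective; toℕ-inject₁; toℕ-inject≤; inject≤-refl; toℕ-inject; toℕ-fromℕ<;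
         all?; ¬∀⟶∃¬-smallest)
open import Data.Fin.Relation.Unary.Top using (view; ‵fromℕ; ‵inject₁)
open import Data.Maybe.Base using (Maybe; just; nothing; maybe; fromMaybe)
open import Data.Maybe.Relation.Unary.All as All using (All; just; nothing)
open import Data.Product using (Σ; ∃; ∃₂; _×_; _,_; proj₁; proj₂)
open import Data.Sum as Sum using (_⊎_; inj₁; inj₂; [_,_]′)
open import Function.Base using (_∘_)
open import Function.Bundles using (_⇔_; mk⇔; module Equivalence)
open import Relation.Nullary using (¬_; Dec; yes; no; contradiction)
open import Relation.Unary using (Decidable)
open import Relation.Binary.PropositionalEquality
  using (_≡_; _≢_; refl; sym; trans; cong; cong₂; subst; subst₂; module ≡-Reasoning)

open Equivalence using (to; from)

module _ where
  open import Data.Nat.Base using (_*_)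
  open import Data.Nat.Properties using (*-comm)
  open import Data.Nat.Divisibility
  open import Data.Nat.GCD
    using (gcd; gcd[m,n]∣m; gcd[m,n]∣n; gcd-greatest; gcd[m,n]≢0; c*gcd[m,n]≡gcd[cm,cn])
  open import Data.Nat.LCM using (lcm; gcd*lcm; lcm[0,n]≡0)

  ∣gcd*gcd : ∀ {d} a b c e → d ∣ a * c → d ∣ a * e → d ∣ b * c → d ∣ b * e →
             d ∣ gcd a b * gcd c e
  ∣gcd*gcd {d} a b c e d∣ac d∣ae d∣bc d∣be = begin
    d                                       ∣⟨ gcd-greatest d∣aG d∣bG ⟩
    gcd (a * gcd c e) (b * gcd c e)         ≡⟨ cong₂ gcd (*-comm a _) (*-comm b _) ⟩
    gcd (gcd c e * a) (gcd c e * b)         ≡⟨ c*gcd[m,n]≡gcd[cm,cn] (gcd c e) a b ⟨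
    gcd c e * gcd a b                       ≡⟨ *-comm (gcd c e) (gcd a b) ⟩
    gcd a b * gcd c e                       ∎
    where
    open ∣-Reasoning
    d∣aG : d ∣ a * gcd c e
    d∣aG = subst (d ∣_) (sym (c*gcd[m,n]≡gcd[cm,cn] a c e)) (gcd-greatest d∣ac d∣ae)
    d∣bG : d ∣ b * gcd c e
    d∣bG = subst (d ∣_) (sym (c*gcd[m,n]≡gcd[cm,cn] b c e)) (gcd-greatest d∣bc d∣be)

  -- g · gcd u v divides u v = gcd u v · lcm u v, where u = gcd r t and v = gcd s t.
  gcd[lcm[r,s],t]∣lcm[gcd[r,t],gcd[s,t]] : ∀ r s t → gcd (lcm r s) t ∣ lcm (gcd r t) (gcd s t)
  gcd[lcm[r,s],t]∣lcm[gcd[r,t],gcd[s,t]] r s t with gcd r t ℕ.≟ 0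
  ... | yes gcd[r,t]≡0 rewrite gcd[r,t]≡0 | lcm[0,n]≡0 (gcd s t) = _ ∣0
  ... | no gcd[r,t]≢0 =
    *-cancelʳ-∣ w {{≢-nonZero (gcd[m,n]≢0 u v (inj₁ gcd[r,t]≢0))}} (begin
      g * w   ∣⟨ ∣gcd*gcd r t s t g*w∣rs g*w∣rt g*w∣ts g*w∣tt ⟩
      u * v   ≡⟨ gcd*lcm u v ⟨
      w * l   ≡⟨ *-comm w l ⟩
      l * w   ∎)
    where
    open ∣-Reasoning
    g u v w l : ℕ
    g = gcd (lcm r s) t
    u = gcd r t
    v = gcd s t
    w = gcd u v
    l = lcm u v
    g∣t : g ∣ t
    g∣t = gcd[m,n]∣n (lcm r s) t
    w∣r : w ∣ r
    w∣r = ∣-trans (gcd[m,n]∣m u v) (gcd[m,n]∣m r t)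
    w∣s : w ∣ s
    w∣s = ∣-trans (gcd[m,n]∣n u v) (gcd[m,n]∣m s t)
    w∣t : w ∣ t
    w∣t = ∣-trans (gcd[m,n]∣m u v) (gcd[m,n]∣n r t)
    g*w∣rs : g * w ∣ r * s
    g*w∣rs = subst (g * w ∣_) (trans (*-comm (lcm r s) (gcd r s)) (gcd*lcm r s))
                   (*-pres-∣ (gcd[m,n]∣m (lcm r s) t) (gcd-greatest w∣r w∣s))
    g*w∣rt : g * w ∣ r * t
    g*w∣rt = subst (g * w ∣_) (*-comm t r) (*-pres-∣ g∣t w∣r)
    g*w∣ts : g * w ∣ t * s
    g*w∣ts = *-pres-∣ g∣t w∣s
    g*w∣tt : g * w ∣ t * t
    g*w∣tt = *-pres-∣ g∣t w∣t

open import Data.Integer.Base using (ℤ; +_; -_; _-_; _*_; _⊖_; ∣_∣; 0ℤ; 1ℤ)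
open import Data.Integer.Properties as ℤ
  using (m-n≡m⊖n; ⊖-≥; pos-*; ∣i-j∣≡∣j-i∣; +-identityʳ; +-inverseʳ; +-minus-telescope)
open import Data.Integer.Divisibility using (_∣_)
import Data.Integer.Divisibility.Signed as Signed
open import Data.Integer.GCD using (gcd; gcd[i,j]∣i; gcd[i,j]∣j; gcd-comm)
open import Data.Integer.LCM using (lcm; i∣lcm[i,j]; j∣lcm[i,j]; lcm-least)
open import Data.Integer.Tactic.RingSolver using (solve-∀)

private variable
  a b c d r s t : ℤ

ℕ-sum⇒ℤ-diff : ∀ {x y z} → x + y ≡ z → + x ≡ + z - + y
ℕ-sum⇒ℤ-diff {x} {y} refl = sym (begin
  + (x + y) - + y   ≡⟨ m-n≡m⊖n (x + y) y ⟩
  (x + y) ⊖ y       ≡⟨ ⊖-≥ (ℕ.m≤n+m y x) ⟩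
  + (x + y ℕ.∸ y)   ≡⟨ cong +_ (ℕ.m+n∸n≡m x y) ⟩
  + x               ∎)
  where open ≡-Reasoning

bézout : ∀ m n → ∃₂ λ x y → gcd (+ m) (+ n) ≡ x * + m - y * + n
bézout m n with ℕ.Bézout.identity (ℕ.gcd-GCD m n)
... | ℕ.Bézout.+- x y eq = + x , + y , (begin
  + ℕ.gcd m n                 ≡⟨ ℕ-sum⇒ℤ-diff eq ⟩
  + (x ℕ.* m) - + (y ℕ.* n)   ≡⟨ cong₂ _-_ (pos-* x m) (pos-* y n) ⟩
  + x * + m - + y * + n       ∎)
  where open ≡-Reasoning
... | ℕ.Bézout.-+ x y eq = - + x , - + y , (begin
  + ℕ.gcd m n                 ≡⟨ ℕ-sum⇒ℤ-diff eq ⟩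
  + (y ℕ.* n) - + (x ℕ.* m)   ≡⟨ cong₂ _-_ (pos-* y n) (pos-* x m) ⟩
  + y * + n - + x * + m       ≡⟨ swap-signs (+ x) (+ m) (+ y) (+ n) ⟩
  - + x * + m - - + y * + n   ∎)
  where
  open ≡-Reasoning
  swap-signs : ∀ x m y n → y * n - x * m ≡ - x * m - - y * n
  swap-signs = solve-∀

infix 4 _≡_mod_

-- A record rather than an abbreviation of d ∣ a - b: the unsigned divisibility
-- only sees ∣ d ∣ and ∣ a - b ∣, so a, b and d could not be inferred.
record _≡_mod_ (a b d : ℤ) : Set where
  constructor ∣⇒≡mod
  field ≡mod⇒∣ : d ∣ a - b
open _≡_mod_ public

≡mod⇒∣ₛ : a ≡ b mod d → d Signed.∣ a - b
≡mod⇒∣ₛ {a} {b} {d} (∣⇒≡mod d∣a-b) = Signed.∣ᵤ⇒∣ {d} {a - b} d∣a-b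

multiple⇒≡mod : ∀ k → a - b ≡ k * + ∣ d ∣ → a ≡ b mod d
multiple⇒≡mod k eq = ∣⇒≡mod (Signed.∣⇒∣ᵤ (Signed.divides k eq))

mod-refl : a ≡ a mod d
mod-refl {a} {d} = ∣⇒≡mod (subst (λ x → ∣ d ∣ ℕ.∣ ∣ x ∣) (sym (+-inverseʳ a)) (∣ d ∣ ℕ.∣0))

mod-sym : a ≡ b mod d → b ≡ a mod d
mod-sym {a} {b} {d} (∣⇒≡mod d∣a-b) = ∣⇒≡mod (subst (∣ d ∣ ℕ.∣_) (∣i-j∣≡∣j-i∣ a b) d∣a-b)

mod-trans : a ≡ b mod d → b ≡ c mod d → a ≡ c mod d
mod-trans {a} {b} {d} {c} a≡b b≡c = ∣⇒≡mod (Signed.∣⇒∣ᵤ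
  (subst (d Signed.∣_) (+-minus-telescope a b c) (Signed.∣m∣n⇒∣m+n (≡mod⇒∣ₛ a≡b) (≡mod⇒∣ₛ b≡c))))

mod-weaken : r ∣ d → a ≡ b mod d → a ≡ b mod r
mod-weaken r∣d (∣⇒≡mod d∣a-b) = ∣⇒≡mod (ℕ.∣-trans r∣d d∣a-b)

mod-one : a ≡ b mod 1ℤ
mod-one = ∣⇒≡mod (ℕ.1∣ _)

∣⇒≡0mod : d ∣ a → a ≡ 0ℤ mod d
∣⇒≡0mod {d} {a} d∣a = ∣⇒≡mod (subst (λ x → ∣ d ∣ ℕ.∣ ∣ x ∣) (sym (+-identityʳ a)) d∣a)

≡0mod⇒∣ : a ≡ 0ℤ mod d → d ∣ a
≡0mod⇒∣ {a} {d} (∣⇒≡mod d∣a-0) = subst (λ x → ∣ d ∣ ℕ.∣ ∣ x ∣) (+-identityʳ a) d∣a-0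

mod-gcdˡ : a ≡ b mod r → a ≡ b mod gcd r s
mod-gcdˡ {r = r} {s = s} = mod-weaken (gcd[i,j]∣i r s)

mod-gcdʳ : a ≡ b mod s → a ≡ b mod gcd r s
mod-gcdʳ {s = s} {r = r} = mod-weaken (gcd[i,j]∣j r s)

mod-trans-gcd : a ≡ b mod r → b ≡ c mod s → a ≡ c mod gcd r s
mod-trans-gcd {r = r} {s = s} a≡b b≡c = mod-trans (mod-gcdˡ {s = s} a≡b) (mod-gcdʳ {r = r} b≡c)

mod-lcm : a ≡ b mod lcm r s ⇔ (a ≡ b mod r × a ≡ b mod s)
mod-lcm {a} {b} {r} {s} = mk⇔
  (λ a≡b → mod-weaken (i∣lcm[i,j] r s) a≡b , mod-weaken (j∣lcm[i,j] r s) a≡b)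
  (λ (∣⇒≡mod r∣a-b , ∣⇒≡mod s∣a-b) → ∣⇒≡mod (lcm-least {r} {s} {a - b} r∣a-b s∣a-b))

mod-gcd-lcm : a ≡ b mod gcd r t → a ≡ b mod gcd s t → a ≡ b mod gcd (lcm r s) t
mod-gcd-lcm {a} {b} {r} {t} {s} (∣⇒≡mod p) (∣⇒≡mod q) =
  ∣⇒≡mod (ℕ.∣-trans (gcd[lcm[r,s],t]∣lcm[gcd[r,t],gcd[s,t]] (∣ r ∣) (∣ s ∣) (∣ t ∣))
                    (lcm-least {gcd r t} {gcd s t} {a - b} p q))

-- From gcd r s = x r - y s and a - b = k gcd r s, take z = a - k x r.
crt-pair : a ≡ b mod gcd r s → ∃ λ c → c ≡ a mod r × c ≡ b mod s
crt-pair {a} {b} {r} {s} a≡b with bézout (∣ r ∣) (∣ s ∣) | ≡mod⇒∣ₛ a≡b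
... | x , y , gcd≡xr-ys | Signed.divides k a-b≡kg =
  z , multiple⇒≡mod (- (k * x)) (z-a≡ a k x R) , multiple⇒≡mod (- (k * y)) z-b≡
  where
  open ≡-Reasoning
  R S z : ℤ
  R = + ∣ r ∣
  S = + ∣ s ∣
  z = a - k * x * R
  z-a≡ : ∀ a k x R → (a - k * x * R) - a ≡ - (k * x) * R
  z-a≡ = solve-∀
  regroup : ∀ a b k x R → (a - k * x * R) - b ≡ (a - b) - k * x * R
  regroup = solve-∀
  cancel : ∀ k x R y S → k * (x * R - y * S) - k * x * R ≡ - (k * y) * S
  cancel = solve-∀
  z-b≡ : z - b ≡ - (k * y) * S
  z-b≡ = begin
    z - b                              ≡⟨ regroup a b k x R ⟩
    (a - b) - k * x * R                ≡⟨ cong (_- k * x * R) a-b≡kg ⟩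
    k * gcd r s - k * x * R            ≡⟨ cong (λ g → k * g - k * x * R) gcd≡xr-ys ⟩
    k * (x * R - y * S) - k * x * R    ≡⟨ cancel k x R y S ⟩
    - (k * y) * S                      ∎

chinese-remainder : ∀ {m} (a r : Fin m → ℤ) →
  (∀ p q → a p ≡ a q mod gcd (r p) (r q)) →
  (∀ p → a p ≡ b mod gcd s (r p)) →
  ∃ λ x → x ≡ b mod s × (∀ p → x ≡ a p mod r p)
chinese-remainder {b = b} {m = zero} a r _ _ = b , mod-refl , λ ()
-- Merge the base congruence with the first one into a congruence modulo lcm s r₀;
-- the remaining ones stay compatible with it by mod-gcd-lcm.
chinese-remainder {b = b} {s = s} {m = suc m} a r pairwise compatible =
  let c , c≡b , c≡a₀ = crt-pair {a = b} {b = a zero} {r = s} {s = r zero}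
                         (mod-sym (compatible zero))
      compatible′ : ∀ p → a (suc p) ≡ c mod gcd (lcm s (r zero)) (r (suc p))
      compatible′ p = mod-gcd-lcm {r = s} {t = r (suc p)} {s = r zero}
        (mod-trans (compatible (suc p)) (mod-gcdˡ {s = r (suc p)} (mod-sym c≡b)))
        (mod-trans (mod-sym (pairwise zero (suc p))) (mod-gcdˡ {s = r (suc p)} (mod-sym c≡a₀)))
      x , x≡c , x≡a = chinese-remainder {b = c} {s = lcm s (r zero)} (a ∘ suc) (r ∘ suc)
                        (λ p q → pairwise (suc p) (suc q)) compatible′
      x≡c[s] , x≡c[r₀] = to (mod-lcm {r = s} {s = r zero}) x≡c
  in x , mod-trans x≡c[s] c≡b , λ { zero → mod-trans x≡c[r₀] c≡a₀ ; (suc p) → x≡a p }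

private variable
  A B : Maybe ℤ
  P : ℤ → Set

just⇒All : ∀ A → (∀ r → A ≡ just r → P r) → All P A
just⇒All (just r) h = just (h r refl)
just⇒All nothing  _ = nothing

All⇒just : All P A → A ≡ just r → P r
All⇒just (just p) refl = p

fromMaybe⇒All : ∀ A → P (fromMaybe d A) → All P A
fromMaybe⇒All (just r) p = just p
fromMaybe⇒All nothing  _ = nothing

All⇒fromMaybe : All P A → P d → P (fromMaybe d A)
All⇒fromMaybe (just p) _ = p
All⇒fromMaybe nothing  p = p

mod-maybe-lcm : ∀ (h : ℤ → ℤ) A →
  a ≡ b mod maybe (λ r → lcm d (h r)) d A ⇔ (a ≡ b mod d × All (λ r → a ≡ b mod h r) A)
mod-maybe-lcm {d = d} h (just r) = mk⇔
  (λ a≡b → let p , q = to (mod-lcm {r = d} {s = h r}) a≡b in p , just q)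
  (λ { (p , just q) → from mod-lcm (p , q) })
mod-maybe-lcm h nothing = mk⇔ (_, nothing) proj₁

mergeLab-mod : ∀ A B →
  All (a ≡ b mod_) (mergeLab A B) ⇔ (All (a ≡ b mod_) A × All (a ≡ b mod_) B)
mergeLab-mod nothing  B        = mk⇔ (nothing ,_) proj₂
mergeLab-mod (just r) nothing  = mk⇔ (_, nothing) proj₁
mergeLab-mod (just r) (just s) = mk⇔
  (λ { (just a≡b) → let p , q = to (mod-lcm {r = r} {s = s}) a≡b in just p , just q })
  (λ { (just p , just q) → just (from mod-lcm (p , q)) })

newLab-mod : All (c ≡ a mod_) A → All (c ≡ b mod_) B → All (a ≡ b mod_) (newLab A B)
newLab-mod (just c≡a) (just c≡b) = just (mod-trans-gcd (mod-sym c≡a) c≡b)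
newLab-mod (just _)   nothing    = nothing
newLab-mod nothing    _          = nothing

newLab-mod⁻ : ∀ A B → All (a ≡ b mod_) (newLab A B) →
  a ≡ b mod gcd (fromMaybe 1ℤ A) (fromMaybe 1ℤ B)
newLab-mod⁻ (just r) (just s) (just a≡b) = a≡b
newLab-mod⁻ (just r) nothing  _          = mod-gcdʳ {s = 1ℤ} {r = r} mod-one
newLab-mod⁻ nothing  B        _          = mod-gcdˡ {r = 1ℤ} {s = fromMaybe 1ℤ B} mod-one

newLab-comm : ∀ A B → newLab A B ≡ newLab B A
newLab-comm (just r) (just s) = cong just (gcd-comm r s)
newLab-comm (just _) nothing  = refl
newLab-comm nothing  (just _) = refl
newLab-comm nothing  nothing  = refl

IsUndirected : ∀ {n} → LGraph n → Set
IsUndirected G = ∀ u w → elab G u w ≡ elab G w u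

IsSplineMod : ∀ {n} → LGraph n → (Fin n → ℤ) → Set
IsSplineMod G f = (∀ v → f v ≡ 0ℤ mod vmod G v) × (∀ u w → All (f u ≡ f w mod_) (elab G u w))

IsSpline⇔IsSplineMod : ∀ {n} (G : LGraph n) f → IsSpline G f ⇔ IsSplineMod G f
IsSpline⇔IsSplineMod G f = mk⇔
  (λ (at-vertex , along-edge) →
    (λ v → ∣⇒≡0mod (at-vertex v)) ,
    (λ u w → just⇒All (elab G u w) (λ r e → ∣⇒≡mod (along-edge u w r e))))
  (λ (at-vertex , along-edge) →
    (λ v → ≡0mod⇒∣ (at-vertex v)) ,
    (λ u w r e → ≡mod⇒∣ (All⇒just (along-edge u w) e)))

IsSpline-cong : ∀ {n} (G : LGraph n) {f h} → (∀ v → f v ≡ h v) → IsSpline G f → IsSpline G h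
IsSpline-cong G f≗h (at-vertex , along-edge) =
  (λ v → subst (vmod G v ∣_) (f≗h v) (at-vertex v)) ,
  (λ u w r e → subst (r ∣_) (cong₂ _-_ (f≗h u) (f≗h w)) (along-edge u w r e))

zero-spline : ∀ {n} (G : LGraph n) {f} → (∀ v → f v ≡ 0ℤ) → IsSpline G f
zero-spline G {f} f≡0 = from (IsSpline⇔IsSplineMod G f)
  ( (λ v → subst (_≡ 0ℤ mod vmod G v) (sym (f≡0 v)) mod-refl)
  , (λ u w → All.universal (λ r → subst₂ (_≡_mod r) (sym (f≡0 u)) (sym (f≡0 w)) mod-refl) _))

infixl 5 _∷ʳ_

_∷ʳ_ : ∀ {n} {X : Set} → (Fin n → X) → X → Fin (suc n) → X
_∷ʳ_ {zero}  g x _       = x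
_∷ʳ_ {suc n} g x zero    = g zero
_∷ʳ_ {suc n} g x (suc i) = (g ∘ suc ∷ʳ x) i

∷ʳ-fromℕ : ∀ {n} {X : Set} (g : Fin n → X) x → (g ∷ʳ x) (fromℕ n) ≡ x
∷ʳ-fromℕ {zero}  g x = refl
∷ʳ-fromℕ {suc n} g x = ∷ʳ-fromℕ (g ∘ suc) x

∷ʳ-inject₁ : ∀ {n} {X : Set} (g : Fin n → X) x i → (g ∷ʳ x) (inject₁ i) ≡ g i
∷ʳ-inject₁ g x zero    = refl
∷ʳ-inject₁ g x (suc i) = ∷ʳ-inject₁ (g ∘ suc) x i

module _ {n : ℕ} (G : LGraph (suc n)) where

  edgeToLast : Fin n → Maybe ℤ
  edgeToLast w = elab G (fromℕ n) (inject₁ w)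

  -- A missing edge imposes no condition, like an edge labelled 1.
  modulusToLast : Fin n → ℤ
  modulusToLast w = fromMaybe 1ℤ (edgeToLast w)

  reduceLast-elab : ∀ {w x} → w ≢ x → elab (reduceLast G) w x ≡
    mergeLab (elab G (inject₁ w) (inject₁ x)) (newLab (edgeToLast w) (edgeToLast x))
  reduceLast-elab {w} {x} w≢x with w ≟ x
  ... | yes w≡x = contradiction w≡x w≢x
  ... | no  _   = refl

  reduceLast-elab-mod⁺ : ∀ w x →
    All (a ≡ b mod_) (elab G (inject₁ w) (inject₁ x)) →
    All (a ≡ b mod_) (newLab (edgeToLast w) (edgeToLast x)) →
    All (a ≡ b mod_) (elab (reduceLast G) w x)
  reduceLast-elab-mod⁺ w x old new with w ≟ x
  ... | yes _ = nothing
  ... | no  _ = from (mergeLab-mod _ _) (old , new)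

  reduceLast-elab-mod⁻ : ∀ {w x} → w ≢ x →
    All (a ≡ b mod_) (elab (reduceLast G) w x) →
    All (a ≡ b mod_) (elab G (inject₁ w) (inject₁ x)) ×
    All (a ≡ b mod_) (newLab (edgeToLast w) (edgeToLast x))
  reduceLast-elab-mod⁻ w≢x reduced =
    to (mergeLab-mod _ _) (subst (All _) (reduceLast-elab w≢x) reduced)

  reduceLast-vmod-mod : ∀ w →
    a ≡ b mod vmod (reduceLast G) w ⇔
    (a ≡ b mod vmod G (inject₁ w) × All (λ r → a ≡ b mod gcd (vmod G (fromℕ n)) r) (edgeToLast w))
  reduceLast-vmod-mod w = mod-maybe-lcm (gcd (vmod G (fromℕ n))) (edgeToLast w)

  reduceLast-undirected : IsUndirected G → IsUndirected (reduceLast G)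
  reduceLast-undirected undirected w x = by-cases (w ≟ x)
    where
    open ≡-Reasoning
    by-cases : Dec (w ≡ x) → elab (reduceLast G) w x ≡ elab (reduceLast G) x w
    by-cases (yes w≡x) = subst (λ y → elab (reduceLast G) w y ≡ elab (reduceLast G) y w) w≡x refl
    by-cases (no w≢x)  = begin
      elab (reduceLast G) w x
        ≡⟨ reduceLast-elab w≢x ⟩
      mergeLab (elab G (inject₁ w) (inject₁ x)) (newLab (edgeToLast w) (edgeToLast x))
        ≡⟨ cong₂ mergeLab (undirected _ _) (newLab-comm _ _) ⟩
      mergeLab (elab G (inject₁ x) (inject₁ w)) (newLab (edgeToLast x) (edgeToLast w))
        ≡⟨ reduceLast-elab (w≢x ∘ sym) ⟨
      elab (reduceLast G) x w
        ∎

  reduceLast-restrict : ∀ {f} → IsSplineMod G f → IsSplineMod (reduceLast G) (f ∘ inject₁)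
  reduceLast-restrict {f} (at-vertex , along-edge) = at-vertex′ , along-edge′
    where
    at-vertex′ : ∀ w → f (inject₁ w) ≡ 0ℤ mod vmod (reduceLast G) w
    at-vertex′ w = from (reduceLast-vmod-mod w)
      ( at-vertex (inject₁ w)
      , All.map (λ f[v]≡f[w] → mod-sym (mod-trans-gcd (mod-sym (at-vertex (fromℕ n))) f[v]≡f[w]))
                (along-edge (fromℕ n) (inject₁ w)))
    along-edge′ : ∀ w x → All (f (inject₁ w) ≡ f (inject₁ x) mod_) (elab (reduceLast G) w x)
    along-edge′ w x = reduceLast-elab-mod⁺ w x
      (along-edge (inject₁ w) (inject₁ x))
      (newLab-mod (along-edge (fromℕ n) (inject₁ w)) (along-edge (fromℕ n) (inject₁ x)))

  reduceLast-pairwise-compatible : ∀ {g} → IsSplineMod (reduceLast G) g →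
    ∀ p q → g p ≡ g q mod gcd (modulusToLast p) (modulusToLast q)
  reduceLast-pairwise-compatible (_ , along-edge) p q with p ≟ q
  ... | yes refl = mod-refl
  ... | no  p≢q  = newLab-mod⁻ (edgeToLast p) (edgeToLast q)
                     (proj₂ (reduceLast-elab-mod⁻ p≢q (along-edge p q)))

  reduceLast-vmod-compatible : ∀ {g} → IsSplineMod (reduceLast G) g →
    ∀ p → g p ≡ 0ℤ mod gcd (vmod G (fromℕ n)) (modulusToLast p)
  reduceLast-vmod-compatible (at-vertex , _) p =
    All⇒fromMaybe (proj₂ (to (reduceLast-vmod-mod p) (at-vertex p)))
                  (mod-gcdʳ {s = 1ℤ} {r = vmod G (fromℕ n)} mod-one)

  reduceLast-extend : IsUndirected G → ∀ {g} → IsSplineMod (reduceLast G) g →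
    ∃ λ x → IsSplineMod G (g ∷ʳ x)
  reduceLast-extend undirected {g} g-spline@(at-vertex , along-edge) =
    extend (chinese-remainder g modulusToLast
              (reduceLast-pairwise-compatible g-spline) (reduceLast-vmod-compatible g-spline))
    where
    extend : (∃ λ x → x ≡ 0ℤ mod vmod G (fromℕ n) × (∀ p → x ≡ g p mod modulusToLast p)) →
             ∃ λ x → IsSplineMod G (g ∷ʳ x)
    extend (x , x≡0 , x≡g) = x , at-vertex′ , along-edge′
      where
      at-vertex′ : ∀ u → (g ∷ʳ x) u ≡ 0ℤ mod vmod G u
      at-vertex′ u with view u
      ... | ‵fromℕ     rewrite ∷ʳ-fromℕ g x     = x≡0
      ... | ‵inject₁ w rewrite ∷ʳ-inject₁ g x w = proj₁ (to (reduceLast-vmod-mod w) (at-vertex w))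
      along-edge′ : ∀ u u′ → All ((g ∷ʳ x) u ≡ (g ∷ʳ x) u′ mod_) (elab G u u′)
      along-edge′ u u′ with view u | view u′
      ... | ‵fromℕ | ‵fromℕ = All.universal (λ _ → mod-refl) _
      ... | ‵fromℕ | ‵inject₁ q rewrite ∷ʳ-fromℕ g x | ∷ʳ-inject₁ g x q =
        fromMaybe⇒All (edgeToLast q) (x≡g q)
      ... | ‵inject₁ p | ‵fromℕ
        rewrite ∷ʳ-fromℕ g x | ∷ʳ-inject₁ g x p | undirected (inject₁ p) (fromℕ n) =
        All.map mod-sym (fromMaybe⇒All (edgeToLast p) (x≡g p))
      ... | ‵inject₁ p | ‵inject₁ q with p ≟ q
      ...   | yes refl = All.universal (λ _ → mod-refl) _
      ...   | no  p≢q rewrite ∷ʳ-inject₁ g x p | ∷ʳ-inject₁ g x q =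
        proj₁ (reduceLast-elab-mod⁻ p≢q (along-edge p q))

inject₁-inject≤ : ∀ {m n} (j : Fin m) .(m≤n : m ≤ n) .(m≤1+n : m ≤ suc n) →
  inject₁ (inject≤ j m≤n) ≡ inject≤ j m≤1+n
inject₁-inject≤ j _ _ =
  toℕ-injective (trans (toℕ-inject₁ _) (trans (toℕ-inject≤ j _) (sym (toℕ-inject≤ j _))))

restrict-spline : ∀ {i} k (G : LGraph (k + i)) f →
  IsSpline G f → IsSpline (reduceMany k G) (restrict k f)
restrict-spline zero G f f-spline =
  IsSpline-cong G (λ j → cong f (sym (inject≤-refl j _))) f-spline
restrict-spline (suc k) G f f-spline =
  IsSpline-cong (reduceMany k (reduceLast G)) (λ j → cong f (inject₁-inject≤ j _ _))
    (restrict-spline k (reduceLast G) (f ∘ inject₁)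
      (from (IsSpline⇔IsSplineMod (reduceLast G) (f ∘ inject₁))
        (reduceLast-restrict G (to (IsSpline⇔IsSplineMod G f) f-spline))))

extend-spline : ∀ {i} k (G : LGraph (k + i)) → IsUndirected G → ∀ g →
  IsSpline (reduceMany k G) g → ∃ λ f → IsSpline G f × (∀ j → restrict k f j ≡ g j)
extend-spline zero G _ g g-spline = g , g-spline , λ j → cong g (inject≤-refl j _)
extend-spline (suc k) G undirected g g-spline =
  let f , f-spline , f|≡g =
        extend-spline k (reduceLast G) (reduceLast-undirected G undirected) g g-spline
      x , f∷x-spline =
        reduceLast-extend G undirected (to (IsSpline⇔IsSplineMod (reduceLast G) f) f-spline)
  in f ∷ʳ x , from (IsSpline⇔IsSplineMod G (f ∷ʳ x)) f∷x-spline ,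
     λ j → trans (cong (f ∷ʳ x) (sym (inject₁-inject≤ j _ _))) (trans (∷ʳ-inject₁ f x _) (f|≡g j))

all-or-first-failure : ∀ {n} {Q : Fin n → Set} → Decidable Q →
  (∀ j → Q j) ⊎ ∃ λ j → ¬ Q j × (∀ s → s < j → Q s)
all-or-first-failure {n} {Q} Q? with all? Q?
... | yes ∀Q = inj₁ ∀Q
... | no ¬∀Q =
  let j , ¬Qj , Q<j = ¬∀⟶∃¬-smallest n Q Q? ¬∀Q
  in inj₂ (j , ¬Qj , λ s s<j → subst Q (inject-fromℕ< s<j) (Q<j (fromℕ< s<j)))
  where
  inject-fromℕ< : ∀ {s j : Fin n} (s<j : s < j) → inject (fromℕ< s<j) ≡ s
  inject-fromℕ< s<j = toℕ-injective (trans (toℕ-inject _) (toℕ-fromℕ< s<j))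

lemma4p6 : (i k : ℕ) → 1 ≤ i → (G : LGraph (k + i)) → IsSimple G → IsConnected G →
    (g : Fin i → ℤ) →
      ((Σ (Fin (k + i) → ℤ) λ f → IsSpline G f × (∀ j → restrict k f j ≡ g j))
        → ((∀ j → g j ≡ 0ℤ) ⊎ Σ (Fin i) λ j → IsFlowUp (reduceMany k G) j g))
      × (((∀ j → g j ≡ 0ℤ) ⊎ Σ (Fin i) λ j → IsFlowUp (reduceMany k G) j g)
        → Σ (Fin (k + i) → ℤ) λ f → IsSpline G f × (∀ j → restrict k f j ≡ g j))
lemma4p6 i k _ G (_ , undirected) _ g =
  (λ (f , f-spline , f|≡g) →
     Sum.map₂ (λ (j , g[j]≢0 , g<j≡0) →
                 let g-spline = IsSpline-cong (reduceMany k G) f|≡g (restrict-spline k G f f-spline)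
                 in j , g-spline , g[j]≢0 , g<j≡0)
              (all-or-first-failure (λ j → g j ℤ.≟ 0ℤ)))
  , [ (λ g≡0 → extend-spline k G undirected g (zero-spline (reduceMany k G) g≡0))
    , (λ (_ , g-spline , _) → extend-spline k G undirected g g-spline) ]′
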